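{- Let $v$ be an $(a-c,b-d)$-bispecial factor of $\mathbf u_\beta$ such that $t_{c\oplus1}t_{c\oplus2}t_{c\oplus3}\cdots\preceq t_{d\oplus1}t_{d\oplus2}t_{d\oplus3}\cdots$ in the lexicographic order. Then for every $n\in\mathbb N$ the $f^n$-image of $v$ equals $u_1\varphi^n(v)u_2$, where $u_2$ is the longest common prefix of $\varphi^n(c)$ and $\varphi^n(d)$ and $u_2=\varphi^n(c)(c\oplus n)^{ -1}$, and $$u_1=\begin{cases}\epsilon & \text{if } p \text{ does not divide } a-b,\\ z^{(n+\min\{a,b\})} & \text{otherwise.}\end{cases}$$
   Context: Let $\beta>1$ be a non-simple Parry number: its Rényi expansion of unity $d_\beta(1)=t_1t_2t_3\cdots$ (nonnegative integers with $t_1=\lfloor\beta\rfloor$, $1=\sum_{i\ge1}t_i\beta^{ -i}$, and $t_it_{i+1}\cdots\prec t_1t_2\cdots$ lexicographically for all $i\ge2$) has the form $t_1\cdots t_m(t_{m+1}\cdots t_{m+p})^\omega$ and is not of the form $t_1\cdots t_k0^\omega$, with $m,p\ge1$ least possible (so $t_m\neq t_{m+p}$). Assume $t_1\ge2$. On $\mathcal A=\{0,1,\dots,m+p-1\}$ let $\varphi$ be the substitution $\varphi(k)=0^{t_{k+1}}(k+1)$ for $0\le k\le m+p-2$, $\varphi(m+p-1)=0^{t_{m+p}}m$, and $\mathbf u_\beta=\lim_n\varphi^n(0)$ its fixed point. For $k,\ell\in\mathbb N$, $k\oplus\ell$ is the letter $k+\ell$ if $k+\ell<m+p$ and $m+((k+\ell-m)\bmod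 p)$ otherwise; for $k+\ell>0$, $t_{k\oplus\ell}$ denotes $t_{k+\ell}$ if $k+\ell\le m+p$ and $t_{m+1+((k+\ell-m-1)\bmod p)}$ otherwise. For words, $xy^{ -1}$ denotes $x$ with its suffix $y$ erased. Let $t=\min\{t_m,t_{m+p}\}$ and let $z$ be the letter $1+\max\{j: 0^j$ is a suffix of $t_{m+1}\cdots t_{m+p}t_{m+1}\cdots t_{m+p-1}\}$ if $t_m>t_{m+p}$, and $1+\max\{j: 0^j$ is a suffix of $t_1\cdots t_{m-1}\}$ if $t_{m+p}>t_m$ (it is the unique nonzero letter with $z0^tm$ a factor of $\mathbf u_\beta$). For $n\in\mathbb N$ write $n=\ell m+k$ with $0\le k<m$; $z^{(n)}=\epsilon$ if $n<m$; $z^{(n)}=\varphi^k(0^tm)\varphi^{k+m}(0^tm)\cdots\varphi^{(\ell-1)m+k}(0^tm)$ if $n\ge m$ and $p$ divides $z$; $z^{(n)}=\varphi^{n-m}(0^tm)$ otherwise. For letters $a\ne b$, $c\ne d$, a factor $v$ is an $(a-c,b-d)$-bispecial factor if $avc$ and $bvd$ are both factors of $\mathbf u_\beta$. For distinct letters $x,y$, $f_L(x,y)$ (resp. $f_R(x,y)$) is the longest common suffix (resp. prefix) of $\varphi(x)$ and $\varphi(y)$. The $f$-image of an $(a-c,b-d)$-bispecial factor $v$ is $f(v)=f_L(a,b)\varphi(v)f_R(c,d)$; it is an $(a'-c',b'-d')$-bispecial factor where, with $\mu=\min\{t_{c\oplus1},t_{d\oplus1}\}$, $c',d'$ are the first letters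 of $0^{t_{c\oplus1}-\mu}(c\oplus1)$ and $0^{t_{d\oplus1}-\mu}(d\oplus1)$, and $a',b'$ are $0$ and $z$ (in some order) if $\{a,b\}=\{m-1,m+p-1\}$ and $a\oplus1,b\oplus1$ otherwise. The $f^n$-image is obtained by applying $f$ $n$ times, updating the extension letters by this rule at each step. -}

module Defs where

open import Data.Nat.Base
open import Data.Nat.Divisibility using (_∣_; _∣?_)
open import Data.Bool.Base using (Bool; true; false; if_then_else_; _∧_; _∨_)
open import Data.List.Base using (List; []; _∷_; [_]; _++_; map; concat; concatMap; reverse; replicate; length; upTo)
open import Data.Product.Base using (_×_; ∃)
open import Data.Sum.Base using (_⊎_)
open import Relation.Binary.PropositionalEquality using (_≡_; _≢_)
open import Relation.Nullary using (¬_; does)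

_≺_ : (ℕ → ℕ) → (ℕ → ℕ) → Set
s ≺ s' = ∃ λ k → (∀ j → j < k → s j ≡ s' j) × s k < s' k

_≼_ : (ℕ → ℕ) → (ℕ → ℕ) → Set
s ≼ s' = (∀ j → s j ≡ s' j) ⊎ (s ≺ s')

headD : ℕ → List ℕ → ℕ
headD d []      = d
headD d (x ∷ _) = x

lookupD : List ℕ → ℕ → ℕ
lookupD []       _       = 0
lookupD (x ∷ _)  zero    = x
lookupD (_ ∷ xs) (suc i) = lookupD xs i

lcp : List ℕ → List ℕ → List ℕ
lcp (x ∷ xs) (y ∷ ys) = if x ≡ᵇ y then x ∷ lcp xs ys else []
lcp _        _        = []

lcs : List ℕ → List ℕ → List ℕ
lcs xs ys = reverse (lcp (reverse xs) (reverse ys))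

lead0 : List ℕ → ℕ
lead0 (zero ∷ xs) = suc (lead0 xs)
lead0 _           = 0

trailingZeros : List ℕ → ℕ
trailingZeros xs = lead0 (reverse xs)

range : ℕ → ℕ → List ℕ
range a n = map (a +_) (upTo n)

-- The setting: d_β(1) = t₁⋯t_m (t_{m+1}⋯t_{m+p})^ω, given by m, p and
-- the values t 1, …, t (m+p) (other values of t are never used).

module Setting (m p : ℕ) {{_ : NonZero m}} {{_ : NonZero p}} (t : ℕ → ℕ) where

  tIdx : ℕ → ℕ
  tIdx i = if i ≤ᵇ m + p then t i else t (suc (m + ((i ∸ m ∸ 1) % p)))

  _⊕_ : ℕ → ℕ → ℕ
  k ⊕ ℓ = if k + ℓ <ᵇ m + p then k + ℓ else m + ((k + ℓ ∸ m) % p)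

  tO : ℕ → ℕ → ℕ
  tO k ℓ = tIdx (k + ℓ)

  -- β is a non-simple Parry number with d_β(1) as above, t₁ ≥ 2,
  -- m, p ≥ 1 least possible (m,p ≥ 1 via the NonZero instances).
  NonSimpleParry : Set
  NonSimpleParry =
      (2 ≤ t 1)
    × (t m ≢ t (m + p))
    × (∀ q → 0 < q → q < p → ¬ (∀ i → m < i → tIdx (i + q) ≡ tIdx i))
    × (∃ λ i → m < i × i ≤ m + p × t i ≢ 0)
    × (∀ i → 2 ≤ i → (λ j → tIdx (i + j)) ≺ (λ j → tIdx (1 + j)))

  Letter : ℕ → Set
  Letter x = x < m + p

  φ : ℕ → List ℕ
  φ k = replicate (tIdx (suc k)) 0 ++ [ k ⊕ 1 ]

  φ* : List ℕ → List ℕ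
  φ* = concatMap φ

  φ^ : ℕ → List ℕ → List ℕ
  φ^ zero    w = w
  φ^ (suc n) w = φ* (φ^ n w)

  -- the fixed point u_β = lim φⁿ(0), as an infinite word
  uβ : ℕ → ℕ
  uβ i = lookupD (φ^ (suc i) [ 0 ]) i

  Factor : List ℕ → Set
  Factor w = ∃ λ i → w ≡ map (λ j → uβ (i + j)) (upTo (length w))

  Bispecial : ℕ → ℕ → ℕ → ℕ → List ℕ → Set
  Bispecial a b c d v =
      Letter a × Letter b × Letter c × Letter d
    × a ≢ b × c ≢ d
    × Factor (a ∷ v ++ [ c ]) × Factor (b ∷ v ++ [ d ])

  tmin : ℕ
  tmin = t m ⊓ t (m + p)

  z : ℕ
  z = if t (m + p) <ᵇ t m
        then suc (trailingZeros (map t (range (suc m) p) ++ map t (range (suc m) (p ∸ 1))))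
        else suc (trailingZeros (map t (range 1 (m ∸ 1))))

  base : List ℕ
  base = replicate tmin 0 ++ [ m ]

  zPow : ℕ → List ℕ
  zPow n =
    if n <ᵇ m then []
    else (if does (p ∣? z)
            then concat (map (λ i → φ^ (n % m + i * m) base) (upTo (n / m)))
            else φ^ (n ∸ m) base)

  fL : ℕ → ℕ → List ℕ
  fL x y = lcs (φ x) (φ y)

  fR : ℕ → ℕ → List ℕ
  fR x y = lcp (φ x) (φ y)

  -- a bispecial factor together with its extension letters
  record BS : Set where
    constructor bs
    field
      la lb rc rd : ℕ
      word : List ℕ

  -- When {a,b} = {m-1, m+p-1}, the letter among a, b whose image φ is
  -- strictly longer than f_L(a,b) = 0^t m gets the left extension 0,
  -- the other one gets z.
  fStep : BS → BS
  fStep (bs a b c d w) = bs a' b' c' d' (fL a b ++ φ* w ++ fR c d)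
    where
    μ : ℕ
    μ = tIdx (suc c) ⊓ tIdx (suc d)
    c' d' : ℕ
    c' = headD 0 (replicate (tIdx (suc c) ∸ μ) 0 ++ [ c ⊕ 1 ])
    d' = headD 0 (replicate (tIdx (suc d) ∸ μ) 0 ++ [ d ⊕ 1 ])
    special : Bool
    special = ((a ≡ᵇ m ∸ 1) ∧ (b ≡ᵇ m + p ∸ 1)) ∨ ((b ≡ᵇ m ∸ 1) ∧ (a ≡ᵇ m + p ∸ 1))
    leftLetter : ℕ → ℕ
    leftLetter x = if tmin <ᵇ tIdx (suc x) then 0 else z
    a' b' : ℕ
    a' = if special then leftLetter a else a ⊕ 1
    b' = if special then leftLetter b else b ⊕ 1

  fIter : ℕ → BS → BS
  fIter zero    B = B
  fIter (suc n) B = fStep (fIter n B)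

  u1 : ℕ → ℕ → ℕ → List ℕ
  u1 a b n = if does (p ∣? ∣ a - b ∣) then zPow (n + a ⊓ b) else []

-- The two sides of fⁿ(v) evolve independently.
--
-- Right side.  Let c′, d′ be the current right extension letters.  While the tails
-- t_{c′⊕1} t_{c′⊕2} ⋯ and t_{d′⊕1} t_{d′⊕2} ⋯ begin with the same digit, f_R(c′, d′) = 0^{t_{c′⊕1}}
-- and both letters advance by ⊕ 1, which shifts the tails; once the first digits differ, the
-- d′-side letter becomes 0 and the Parry condition t_i t_{i+1} ⋯ ≺ t_1 t_2 ⋯ keeps the order
-- strict.  Hence φⁿ(c) and φⁿ(d) agree exactly up to the accumulated right part, where φⁿ(c)
-- ends with c ⊕ n.  Equal tails are impossible: they would make the digits (d − c)-periodic,
-- against t_m ≠ t_{m+p} and the minimality of p.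
--
-- Left side.  f_L(a′, b′) = ε unless {a′, b′} = {m − 1, m + p − 1}, in which case f_L = 0^t m and
-- the new pair is {0, z}.  That pair is congruent mod p and ⊕ 1 preserves and reflects congruence,
-- so it occurs only when p ∣ a − b; the smaller letter then climbs by one per step, and the pair
-- occurs when n + min{a, b} ≡ m − 1 (mod m): every time if p ∣ z, only the first time otherwise.
-- Writing N = n + min{a, b} = r + q m, the accumulated left part is therefore z^{(N)}.

module Submission where

open import Defs
open import Data.Bool.Base using (true; false; if_then_else_)
open import Data.List.Base using (List; []; _∷_; [_]; _++_; map; concat; concatMap; reverse; replicate; length; upTo)
open import Data.List.Properties
  using (++-assoc; ++-identityʳ; concatMap-++; reverse-++; unfold-reverse; length-reverse; length-++; length-map;
         length-upTo; map-++; upTo-∷ʳ; map-∘; map-upTo; map-applyUpTo)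
open import Data.List.Membership.Propositional using (_∈_)
open import Data.List.Membership.Propositional.Properties using (∈-∃++; ∈-map⁺; ∈-upTo⁺)
open import Data.Nat.Base
open import Data.Nat.Properties
open import Data.Nat.DivMod
open import Data.Nat.Divisibility using (_∣_; _∣?_; divides; ∣⇒≤; n∣m*n)
open import Data.Nat.Tactic.RingSolver using (solve-∀)
open import Data.Product.Base using (_×_; _,_; proj₁; proj₂; ∃)
open import Data.Sum.Base using (_⊎_; inj₁; inj₂)
open import Function.Base using (_∘_)
open import Function.Bundles using (_⇔_; mk⇔; Equivalence)
open import Relation.Binary.PropositionalEquality hiding ([_])
open import Relation.Binary.Definitions using (tri<; tri≈; tri>)
open import Relation.Nullary using (¬_; Dec; yes; no; does; contradiction)
open import Relation.Nullary.Decidable using (_×-dec_; _⊎-dec_)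

if-yes : ∀ {P A : Set} (P? : Dec P) {x y : A} → P → (if does P? then x else y) ≡ x
if-yes (yes _) _  = refl
if-yes (no ¬p) p = contradiction p ¬p

if-no : ∀ {P A : Set} (P? : Dec P) {x y : A} → ¬ P → (if does P? then x else y) ≡ y
if-no (yes p) ¬p = contradiction p ¬p
if-no (no _)  _  = refl

if-elim : ∀ {A : Set} (P : A → Set) b {x y : A} → P x → P y → P (if b then x else y)
if-elim P true  px _  = px
if-elim P false _  py = py

replicate-∷ʳ : ∀ {A : Set} n (x : A) → replicate n x ++ [ x ] ≡ x ∷ replicate n x
replicate-∷ʳ zero    x = refl
replicate-∷ʳ (suc n) x = cong (x ∷_) (replicate-∷ʳ n x)

reverse-replicate : ∀ {A : Set} n (x : A) → reverse (replicate n x) ≡ replicate n x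
reverse-replicate zero    x = refl
reverse-replicate (suc n) x = begin
  reverse (x ∷ replicate n x)    ≡⟨ unfold-reverse x (replicate n x) ⟩
  reverse (replicate n x) ++ [ x ] ≡⟨ cong (_++ [ x ]) (reverse-replicate n x) ⟩
  replicate n x ++ [ x ]           ≡⟨ replicate-∷ʳ n x ⟩
  x ∷ replicate n x                ∎
  where open ≡-Reasoning

replicate-+-∷ : ∀ {A : Set} i j (x : A) → replicate (i + suc j) x ≡ replicate i x ++ x ∷ replicate j x
replicate-+-∷ zero    j x = refl
replicate-+-∷ (suc i) j x = cong (x ∷_) (replicate-+-∷ i j x)

concatMap-concat : ∀ {A B : Set} (f : A → List B) xss → concatMap f (concat xss) ≡ concat (map (concatMap f) xss)
concatMap-concat f []         = refl
concatMap-concat f (xs ∷ xss) = trans (concatMap-++ f xs (concat xss)) (cong (concatMap f xs ++_) (concatMap-concat f xss))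

lcp-++-∷ : ∀ u {x y} xs ys → x ≢ y → lcp (u ++ x ∷ xs) (u ++ y ∷ ys) ≡ u
lcp-++-∷ []      {x} {y} xs ys x≢y = if-no (x ≟ y) x≢y
lcp-++-∷ (w ∷ u) xs ys x≢y = trans (if-yes (w ≟ w) refl) (cong (w ∷_) (lcp-++-∷ u xs ys x≢y))

lcp-replicate : ∀ i j x → lcp (replicate i x) (replicate j x) ≡ replicate (i ⊓ j) x
lcp-replicate zero    j       x = refl
lcp-replicate (suc i) zero    x = refl
lcp-replicate (suc i) (suc j) x = trans (if-yes (x ≟ x) refl) (cong (x ∷_) (lcp-replicate i j x))

lead0-++-∷ : ∀ A {u} B → u ≢ 0 → lead0 (A ++ u ∷ B) ≤ length A
lead0-++-∷ []          {zero}  B u≢0 = contradiction refl u≢0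
lead0-++-∷ []          {suc u} B u≢0 = z≤n
lead0-++-∷ (zero ∷ A)  B u≢0 = s≤s (lead0-++-∷ A B u≢0)
lead0-++-∷ (suc _ ∷ A) B u≢0 = z≤n

lead0≤length : ∀ xs → lead0 xs ≤ length xs
lead0≤length []          = z≤n
lead0≤length (zero ∷ xs) = s≤s (lead0≤length xs)
lead0≤length (suc _ ∷ _) = z≤n

trailingZeros≤length : ∀ xs → trailingZeros xs ≤ length xs
trailingZeros≤length xs = subst (lead0 (reverse xs) ≤_) (length-reverse xs) (lead0≤length (reverse xs))

trailingZeros-++-∷ : ∀ A {u} B → u ≢ 0 → trailingZeros (A ++ u ∷ B) ≤ length B
trailingZeros-++-∷ A {u} B u≢0 = begin
  lead0 (reverse (A ++ u ∷ B))        ≡⟨ cong lead0 reversed ⟩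
  lead0 (reverse B ++ u ∷ reverse A)  ≤⟨ lead0-++-∷ (reverse B) (reverse A) u≢0 ⟩
  length (reverse B)                  ≡⟨ length-reverse B ⟩
  length B                            ∎
  where
  open ≤-Reasoning
  reversed : reverse (A ++ u ∷ B) ≡ reverse B ++ u ∷ reverse A
  reversed = trans (reverse-++ A (u ∷ B))
                   (trans (cong (_++ reverse A) (unfold-reverse u B)) (++-assoc (reverse B) [ u ] (reverse A)))

trailingZeros-++-∈ : ∀ A {u B} → u ∈ B → u ≢ 0 → trailingZeros (A ++ B) ≤ length B
trailingZeros-++-∈ A {u} u∈B u≢0 with ∈-∃++ u∈B
... | C , D , refl = begin
  trailingZeros (A ++ C ++ u ∷ D)   ≡⟨ cong trailingZeros (sym (++-assoc A C (u ∷ D))) ⟩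
  trailingZeros ((A ++ C) ++ u ∷ D) ≤⟨ trailingZeros-++-∷ (A ++ C) D u≢0 ⟩
  length D                          ≤⟨ m≤n+m (length D) (suc (length C)) ⟩
  suc (length C) + length D         ≡⟨ sym (+-suc (length C) (length D)) ⟩
  length C + length (u ∷ D)         ≡⟨ sym (length-++ C) ⟩
  length (C ++ u ∷ D)               ∎
  where open ≤-Reasoning

≺-cong : ∀ {s s′ r r′ : ℕ → ℕ} → (∀ j → s j ≡ s′ j) → (∀ j → r j ≡ r′ j) → s ≺ r → s′ ≺ r′
≺-cong s≗s′ r≗r′ (k , agree , lt) =
  k , (λ j j<k → trans (sym (s≗s′ j)) (trans (agree j j<k) (r≗r′ j))) , subst₂ _<_ (s≗s′ k) (r≗r′ k) lt

≺-irrefl : ∀ {s : ℕ → ℕ} → ¬ s ≺ s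
≺-irrefl (k , _ , lt) = <-irrefl refl lt

PeriodicAfter : ℕ → ℕ → (ℕ → ℕ) → Set
PeriodicAfter k q f = ∀ i → k < i → f (i + q) ≡ f i

periodicAfter-* : ∀ {k q f} → PeriodicAfter k q f → ∀ K → PeriodicAfter k (K * q) f
periodicAfter-* {f = f} per zero    i k<i = cong f (+-identityʳ i)
periodicAfter-* {k} {q} {f} per (suc K) i k<i = begin
  f (i + (q + K * q)) ≡⟨ cong f (sym (+-assoc i q (K * q))) ⟩
  f (i + q + K * q)   ≡⟨ periodicAfter-* per K (i + q) (<-≤-trans k<i (m≤m+n i q)) ⟩
  f (i + q)           ≡⟨ per i k<i ⟩
  f i                 ∎
  where open ≡-Reasoning

record Fork (u : List ℕ) (x y : ℕ) (w w′ : List ℕ) : Set where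
  constructor fork
  field
    rest   : List ℕ
    left≡  : w ≡ u ++ [ x ]
    right≡ : w′ ≡ u ++ y ∷ rest

lcp-fork : ∀ {u x y w w′} → x ≢ y → Fork u x y w w′ → lcp w w′ ≡ u
lcp-fork {u} x≢y (fork rest refl refl) = lcp-++-∷ u [] rest x≢y

module _ (p : ℕ) .{{_ : NonZero p}} where

  [m%n+o]%n≡[m+o]%n : ∀ x k → (x % p + k) % p ≡ (x + k) % p
  [m%n+o]%n≡[m+o]%n x k = begin
    (x % p + k) % p         ≡⟨ %-distribˡ-+ (x % p) k p ⟩
    (x % p % p + k % p) % p ≡⟨ cong (λ r → (r + k % p) % p) (m%n%n≡m%n x p) ⟩
    (x % p + k % p) % p     ≡⟨ sym (%-distribˡ-+ x k p) ⟩
    (x + k) % p             ∎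
    where open ≡-Reasoning

  %≡%⇔∣∸ : ∀ {x y} → x ≤ y → x % p ≡ y % p ⇔ p ∣ y ∸ x
  %≡%⇔∣∸ {x} {y} x≤y = mk⇔ to from
    where
    open ≡-Reasoning
    to : x % p ≡ y % p → p ∣ y ∸ x
    to eq = divides (y / p ∸ x / p) (begin
      y ∸ x                                       ≡⟨ cong₂ _∸_ (m≡m%n+[m/n]*n y p) (m≡m%n+[m/n]*n x p) ⟩
      (y % p + y / p * p) ∸ (x % p + x / p * p)   ≡⟨ cong (λ r → (r + y / p * p) ∸ (x % p + x / p * p)) (sym eq) ⟩
      (x % p + y / p * p) ∸ (x % p + x / p * p)   ≡⟨ [m+n]∸[m+o]≡n∸o (x % p) _ _ ⟩
      y / p * p ∸ x / p * p                       ≡⟨ sym (*-distribʳ-∸ p (y / p) (x / p)) ⟩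
      (y / p ∸ x / p) * p                         ∎)
    from : p ∣ y ∸ x → x % p ≡ y % p
    from p∣y∸x = sym (trans (%-congˡ (sym (m+[n∸m]≡n x≤y))) (%-remove-+ʳ x p∣y∸x))

  %≡%⇔∣∣-∣ : ∀ x y → x % p ≡ y % p ⇔ p ∣ ∣ x - y ∣
  %≡%⇔∣∣-∣ x y with ≤-total x y
  ... | inj₁ x≤y = subst (λ k → x % p ≡ y % p ⇔ p ∣ k) (sym (m≤n⇒∣m-n∣≡n∸m x≤y)) (%≡%⇔∣∸ x≤y)
  ... | inj₂ y≤x = mk⇔ (λ eq → subst (p ∣_) dist (to (sym eq))) (λ p∣ → sym (from (subst (p ∣_) (sym dist) p∣)))
    where
    open Equivalence (%≡%⇔∣∸ y≤x)
    dist : x ∸ y ≡ ∣ x - y ∣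
    dist = sym (trans (∣-∣-comm x y) (m≤n⇒∣m-n∣≡n∸m y≤x))

module Expansion (m p : ℕ) {{_ : NonZero m}} {{_ : NonZero p}} (t : ℕ → ℕ) where
  open Setting m p t

  -- Letters, ⊕ and congruence mod p

  m<m+p : m < m + p
  m<m+p = m<m+n m (>-nonZero⁻¹ p)

  0<m+p : 0 < m + p
  0<m+p = <-≤-trans (>-nonZero⁻¹ m) (m≤m+n m p)

  _≡ₚ_ : ℕ → ℕ → Set
  x ≡ₚ y = x % p ≡ y % p

  suc-≡ₚ : ∀ {x y} → x ≡ₚ y → suc x ≡ₚ suc y
  suc-≡ₚ {x} {y} = Equivalence.from (%≡%⇔∣∣-∣ p (suc x) (suc y)) ∘ Equivalence.to (%≡%⇔∣∣-∣ p x y)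

  suc-≡ₚ⁻¹ : ∀ {x y} → suc x ≡ₚ suc y → x ≡ₚ y
  suc-≡ₚ⁻¹ {x} {y} = Equivalence.from (%≡%⇔∣∣-∣ p x y) ∘ Equivalence.to (%≡%⇔∣∣-∣ p (suc x) (suc y))

  ≡ₚ-gap : ∀ {x y} → x < y → x ≡ₚ y → x + p ≤ y
  ≡ₚ-gap {x} {y} x<y x≡ₚy = begin
    x + p       ≤⟨ +-monoʳ-≤ x (∣⇒≤ {{>-nonZero (m<n⇒0<n∸m x<y)}} p∣y∸x) ⟩
    x + (y ∸ x) ≡⟨ m+[n∸m]≡n (<⇒≤ x<y) ⟩
    y           ∎
    where
    open ≤-Reasoning
    p∣y∸x = Equivalence.to (%≡%⇔∣∸ p (<⇒≤ x<y)) x≡ₚy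

  wrap : ℕ → ℕ
  wrap i = if i <ᵇ m + p then i else m + (i ∸ m) % p

  wrap-< : ∀ {i} → i < m + p → wrap i ≡ i
  wrap-< {i} i<m+p = if-yes (i <? m + p) i<m+p

  wrap-≥ : ∀ {i} → m + p ≤ i → wrap i ≡ m + (i ∸ m) % p
  wrap-≥ {i} m+p≤i = if-no (i <? m + p) (≤⇒≯ m+p≤i)

  wrap-letter : ∀ i → Letter (wrap i)
  wrap-letter i with i <? m + p
  ... | yes i<m+p = subst Letter (sym (wrap-< i<m+p)) i<m+p
  ... | no  i≮m+p = subst Letter (sym (wrap-≥ (≮⇒≥ i≮m+p))) (+-monoʳ-< m (m%n<n (i ∸ m) p))

  wrap-m+ : ∀ r → wrap (m + r) ≡ m + r % p
  wrap-m+ r with r <? p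
  ... | yes r<p = trans (wrap-< (+-monoʳ-< m r<p)) (cong (m +_) (sym (m<n⇒m%n≡m r<p)))
  ... | no  r≮p = trans (wrap-≥ (+-monoʳ-≤ m (≮⇒≥ r≮p))) (cong (λ k → m + k % p) (m+n∸m≡n m r))

  wrap-wrap-+1 : ∀ i → wrap (wrap i + 1) ≡ wrap (i + 1)
  wrap-wrap-+1 i with i <? m + p
  ... | yes i<m+p = cong (λ k → wrap (k + 1)) (wrap-< i<m+p)
  ... | no  i≮m+p = begin
    wrap (wrap i + 1)            ≡⟨ cong (λ k → wrap (k + 1)) (wrap-≥ m+p≤i) ⟩
    wrap (m + (i ∸ m) % p + 1)   ≡⟨ cong wrap (+-assoc m _ 1) ⟩
    wrap (m + ((i ∸ m) % p + 1)) ≡⟨ wrap-m+ _ ⟩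
    m + ((i ∸ m) % p + 1) % p    ≡⟨ cong (m +_) ([m%n+o]%n≡[m+o]%n p (i ∸ m) 1) ⟩
    m + (i ∸ m + 1) % p          ≡⟨ cong (λ k → m + k % p) (sym (+-∸-comm 1 (≤-trans (m≤m+n m p) m+p≤i))) ⟩
    m + (i + 1 ∸ m) % p          ≡⟨ sym (wrap-≥ (≤-trans m+p≤i (m≤m+n i 1))) ⟩
    wrap (i + 1)                 ∎
    where
    open ≡-Reasoning
    m+p≤i = ≮⇒≥ i≮m+p

  ⊕-letter : ∀ k ℓ → Letter (k ⊕ ℓ)
  ⊕-letter k ℓ = wrap-letter (k + ℓ)

  ⊕-identityʳ : ∀ {x} → Letter x → x ⊕ 0 ≡ x
  ⊕-identityʳ {x} x<m+p = trans (wrap-< (subst Letter (sym (+-identityʳ x)) x<m+p)) (+-identityʳ x)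

  ⊕-suc : ∀ k n → (k ⊕ n) ⊕ 1 ≡ k ⊕ suc n
  ⊕-suc k n = trans (wrap-wrap-+1 (k + n)) (cong wrap (trans (+-assoc k n 1) (cong (k +_) (+-comm n 1))))

  ⊕1-inner : ∀ {x} → suc x < m + p → x ⊕ 1 ≡ suc x
  ⊕1-inner {x} sx<m+p = trans (wrap-< (subst Letter (sym (+-comm x 1)) sx<m+p)) (+-comm x 1)

  ⊕1-top : ∀ {x} → suc x ≡ m + p → x ⊕ 1 ≡ m
  ⊕1-top {x} sx≡m+p = begin
    wrap (x + 1) ≡⟨ cong wrap (trans (+-comm x 1) sx≡m+p) ⟩
    wrap (m + p) ≡⟨ wrap-m+ p ⟩
    m + p % p    ≡⟨ cong (m +_) (n%n≡0 p) ⟩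
    m + 0        ≡⟨ +-identityʳ m ⟩
    m            ∎
    where open ≡-Reasoning

  ⊕1-view : ∀ {x} → Letter x → (suc x < m + p × x ⊕ 1 ≡ suc x) ⊎ (suc x ≡ m + p × x ⊕ 1 ≡ m)
  ⊕1-view {x} x<m+p with suc x <? m + p
  ... | yes sx<m+p = inj₁ (sx<m+p , ⊕1-inner sx<m+p)
  ... | no  sx≮m+p = inj₂ (sx≡m+p , ⊕1-top sx≡m+p)
    where sx≡m+p = ≤-antisym x<m+p (≮⇒≥ sx≮m+p)

  ⊕1≢0 : ∀ {x} → Letter x → x ⊕ 1 ≢ 0
  ⊕1≢0 x<m+p with ⊕1-view x<m+p
  ... | inj₁ (_ , x⊕1≡sx) = 1+n≢0 ∘ trans (sym x⊕1≡sx)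
  ... | inj₂ (_ , x⊕1≡m)  = ≢-nonZero⁻¹ m ∘ trans (sym x⊕1≡m)

  ⊕1-≡ₚ-suc : ∀ {x} → Letter x → (x ⊕ 1) ≡ₚ suc x
  ⊕1-≡ₚ-suc x<m+p with ⊕1-view x<m+p
  ... | inj₁ (_ , x⊕1≡sx)      = cong (_% p) x⊕1≡sx
  ... | inj₂ (sx≡m+p , x⊕1≡m) =
    trans (cong (_% p) x⊕1≡m) (trans (sym ([m+n]%n≡m%n m p)) (cong (_% p) (sym sx≡m+p)))

  ⊕1-pres-≡ₚ : ∀ {x y} → Letter x → Letter y → x ≡ₚ y → (x ⊕ 1) ≡ₚ (y ⊕ 1)
  ⊕1-pres-≡ₚ x<m+p y<m+p x≡ₚy = trans (⊕1-≡ₚ-suc x<m+p) (trans (suc-≡ₚ x≡ₚy) (sym (⊕1-≡ₚ-suc y<m+p)))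

  ⊕1-pres-≢ₚ : ∀ {x y} → Letter x → Letter y → ¬ x ≡ₚ y → ¬ (x ⊕ 1) ≡ₚ (y ⊕ 1)
  ⊕1-pres-≢ₚ x<m+p y<m+p x≢ₚy x⊕1≡ₚy⊕1 =
    x≢ₚy (suc-≡ₚ⁻¹ (trans (sym (⊕1-≡ₚ-suc x<m+p)) (trans x⊕1≡ₚy⊕1 (⊕1-≡ₚ-suc y<m+p))))

  ⊕1-≥ : ∀ {y r} → Letter y → r ≤ y → suc r ≤ m → suc r ≤ y ⊕ 1
  ⊕1-≥ y<m+p r≤y sr≤m with ⊕1-view y<m+p
  ... | inj₁ (_ , y⊕1≡sy) = subst (suc _ ≤_) (sym y⊕1≡sy) (s≤s r≤y)
  ... | inj₂ (_ , y⊕1≡m)  = subst (suc _ ≤_) (sym y⊕1≡m) sr≤m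

  -- The digits tᵢ and their tails

  tIdx-≤ : ∀ {i} → i ≤ m + p → tIdx i ≡ t i
  tIdx-≤ {i} i≤m+p = if-yes (i ≤? m + p) i≤m+p

  tIdx-suc-m+ : ∀ k → tIdx (suc (m + k)) ≡ t (suc (m + k % p))
  tIdx-suc-m+ k with suc (m + k) ≤? m + p
  ... | yes ≤m+p = trans (tIdx-≤ ≤m+p) (cong (λ j → t (suc (m + j))) (sym (m<n⇒m%n≡m k<p)))
    where k<p = +-cancelˡ-≤ m (suc k) p (subst (_≤ m + p) (sym (+-suc m k)) ≤m+p)
  ... | no  ≰m+p = trans (if-no (suc (m + k) ≤? m + p) ≰m+p) (cong (λ j → t (suc (m + j % p))) offset)
    where
    offset : suc (m + k) ∸ m ∸ 1 ≡ k
    offset = cong pred (trans (cong (_∸ m) (sym (+-suc m k))) (m+n∸m≡n m (suc k)))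

  tIdx-periodic : PeriodicAfter m p tIdx
  tIdx-periodic i m<i = begin
    tIdx (i + p)               ≡⟨ cong (λ j → tIdx (j + p)) (sym i≡) ⟩
    tIdx (suc (m + k + p))     ≡⟨ cong (tIdx ∘ suc) (+-assoc m k p) ⟩
    tIdx (suc (m + (k + p)))   ≡⟨ tIdx-suc-m+ (k + p) ⟩
    t (suc (m + (k + p) % p))  ≡⟨ cong (λ j → t (suc (m + j))) ([m+n]%n≡m%n k p) ⟩
    t (suc (m + k % p))        ≡⟨ sym (tIdx-suc-m+ k) ⟩
    tIdx (suc (m + k))         ≡⟨ cong tIdx i≡ ⟩
    tIdx i                     ∎
    where
    open ≡-Reasoning
    k = i ∸ suc m
    i≡ : suc (m + k) ≡ i
    i≡ = m+[n∸m]≡n m<i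

  tFrom : ℕ → ℕ → ℕ
  tFrom x j = tIdx (x + suc j)

  tFrom-head : ∀ x → tFrom x 0 ≡ tIdx (suc x)
  tFrom-head x = cong tIdx (+-comm x 1)

  tFrom-⊕1 : ∀ {x} → Letter x → ∀ j → tFrom (x ⊕ 1) j ≡ tFrom x (suc j)
  tFrom-⊕1 {x} x<m+p j with ⊕1-view x<m+p
  ... | inj₁ (_ , x⊕1≡sx) = cong tIdx (trans (cong (_+ suc j) x⊕1≡sx) (sym (+-suc x (suc j))))
  ... | inj₂ (sx≡m+p , x⊕1≡m) = begin
    tIdx (x ⊕ 1 + suc j)   ≡⟨ cong (λ y → tIdx (y + suc j)) x⊕1≡m ⟩
    tIdx (m + suc j)       ≡⟨ cong tIdx (+-suc m j) ⟩
    tIdx (suc (m + j))     ≡⟨ sym (tIdx-periodic (suc (m + j)) (s≤s (m≤m+n m j))) ⟩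
    tIdx (suc (m + j) + p) ≡⟨ cong tIdx (trans (rearrange m p j) (cong (_+ suc j) (sym sx≡m+p))) ⟩
    tIdx (suc x + suc j)   ≡⟨ cong tIdx (sym (+-suc x (suc j))) ⟩
    tIdx (x + suc (suc j)) ∎
    where
    open ≡-Reasoning
    rearrange : ∀ m p j → suc (m + j) + p ≡ m + p + suc j
    rearrange = solve-∀

  tFrom-≺⇒≢ : ∀ {x y} → tFrom x ≺ tFrom y → x ≢ y
  tFrom-≺⇒≢ x≺y refl = ≺-irrefl x≺y

  equal-tails⇒periodic : ∀ {c d} → c < d → (∀ j → tFrom c j ≡ tFrom d j) → PeriodicAfter c (d ∸ c) tIdx
  equal-tails⇒periodic {c} {d} c<d same i c<i = sym (subst₂ (λ u v → tIdx u ≡ tIdx v) c+j≡i d+j≡i+q (same j))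
    where
    j = i ∸ suc c
    q = d ∸ c
    c+j≡i : c + suc j ≡ i
    c+j≡i = trans (+-suc c j) (m+[n∸m]≡n c<i)
    rearrange : ∀ c q s → c + q + s ≡ c + s + q
    rearrange = solve-∀
    d+j≡i+q : d + suc j ≡ i + q
    d+j≡i+q = trans (cong (_+ suc j) (sym (m+[n∸m]≡n (<⇒≤ c<d))))
                    (trans (rearrange c q (suc j)) (cong (_+ q) c+j≡i))

  periodic-before-m⇒tm≡tm+p : ∀ {c q} → c < m → 0 < q → PeriodicAfter c q tIdx → t m ≡ t (m + p)
  periodic-before-m⇒tm≡tm+p {c} {q} c<m q>0 per = begin
    t m                  ≡⟨ sym (tIdx-≤ (m≤m+n m p)) ⟩
    tIdx m               ≡⟨ sym (per* m c<m) ⟩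
    tIdx (m + p * q)     ≡⟨ sym (tIdx-periodic (m + p * q) (m<m+n m (*-mono-< (>-nonZero⁻¹ p) q>0))) ⟩
    tIdx (m + p * q + p) ≡⟨ cong tIdx (rearrange m p q) ⟩
    tIdx (m + p + p * q) ≡⟨ per* (m + p) (<-trans c<m m<m+p) ⟩
    tIdx (m + p)         ≡⟨ tIdx-≤ ≤-refl ⟩
    t (m + p)            ∎
    where
    open ≡-Reasoning
    per* = periodicAfter-* per p
    rearrange : ∀ m p q → m + p * q + p ≡ m + p + p * q
    rearrange = solve-∀

  periodic-after-m : ∀ {c q} → m ≤ c → c < m + p → PeriodicAfter c q tIdx → PeriodicAfter m q tIdx
  periodic-after-m {c} {q} m≤c c<m+p per i m<i = begin
    tIdx (i + q)     ≡⟨ sym (tIdx-periodic (i + q) (<-≤-trans m<i (m≤m+n i q))) ⟩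
    tIdx (i + q + p) ≡⟨ cong tIdx (+-comm-right i q p) ⟩
    tIdx (i + p + q) ≡⟨ per (i + p) (<-≤-trans c<m+p (+-monoˡ-≤ p (<⇒≤ m<i))) ⟩
    tIdx (i + p)     ≡⟨ tIdx-periodic i m<i ⟩
    tIdx i           ∎
    where
    open ≡-Reasoning
    +-comm-right : ∀ i q p → i + q + p ≡ i + p + q
    +-comm-right = solve-∀

  module _ (tm≢tm+p : t m ≢ t (m + p)) (minimal-period : ∀ q → 0 < q → q < p → ¬ PeriodicAfter m q tIdx) where

    tails-differ : ∀ {c d} → c < d → Letter d → ¬ (∀ j → tFrom c j ≡ tFrom d j)
    tails-differ {c} {d} c<d d<m+p same with c <? m
    ... | yes c<m = tm≢tm+p (periodic-before-m⇒tm≡tm+p c<m (m<n⇒0<n∸m c<d) per)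
      where per = equal-tails⇒periodic c<d same
    ... | no  c≮m = minimal-period (d ∸ c) (m<n⇒0<n∸m c<d) q<p
                      (periodic-after-m (≮⇒≥ c≮m) (<-trans c<d d<m+p) (equal-tails⇒periodic c<d same))
      where
      q<p : d ∸ c < p
      q<p = +-cancelˡ-< c (d ∸ c) p (begin-strict
        c + (d ∸ c) ≡⟨ m+[n∸m]≡n (<⇒≤ c<d) ⟩
        d           <⟨ d<m+p ⟩
        m + p       ≤⟨ +-monoˡ-≤ p (≮⇒≥ c≮m) ⟩
        c + p       ∎)
        where open ≤-Reasoning

    tFrom-injective : ∀ {c d} → Letter c → Letter d → (∀ j → tFrom c j ≡ tFrom d j) → c ≡ d
    tFrom-injective {c} {d} c<m+p d<m+p same with <-cmp c d
    ... | tri< c<d _ _ = contradiction same (tails-differ c<d d<m+p)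
    ... | tri≈ _ c≡d _ = c≡d
    ... | tri> _ _ d<c = contradiction (sym ∘ same) (tails-differ d<c c<m+p)

    tFrom-≼⇒≺ : ∀ {c d} → Letter c → Letter d → c ≢ d → tFrom c ≼ tFrom d → tFrom c ≺ tFrom d
    tFrom-≼⇒≺ c<m+p d<m+p c≢d (inj₁ same) = contradiction (tFrom-injective c<m+p d<m+p same) c≢d
    tFrom-≼⇒≺ _     _     _   (inj₂ c≺d)  = c≺d

  tFrom-≺-tFrom0 : (∀ i → 2 ≤ i → (λ j → tIdx (i + j)) ≺ (λ j → tIdx (1 + j))) →
                   ∀ {y} → 0 < y → tFrom y ≺ tFrom 0
  tFrom-≺-tFrom0 parry {y} y>0 = ≺-cong (λ j → cong tIdx (sym (+-suc y j))) (λ _ → refl) (parry (suc y) (s≤s y>0))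

  -- The letter z and the words z^{(n)}

  periodDigits : ℕ → List ℕ
  periodDigits k = map t (range (suc m) k)

  length-digits : ∀ i k → length (map t (range i k)) ≡ k
  length-digits i k = trans (length-map t (range i k)) (trans (length-map (i +_) (upTo k)) (length-upTo k))

  periodDigits-p : periodDigits p ≡ periodDigits (p ∸ 1) ++ [ t (m + p) ]
  periodDigits-p = begin
    map t (map (suc m +_) (upTo p))                               ≡⟨ cong (map t ∘ map (suc m +_)) upTo-p ⟩
    map t (map (suc m +_) (upTo (p ∸ 1) ++ [ p ∸ 1 ]))            ≡⟨ cong (map t) (map-++ (suc m +_) (upTo (p ∸ 1)) _) ⟩
    map t (map (suc m +_) (upTo (p ∸ 1)) ++ [ suc m + (p ∸ 1) ]) ≡⟨ map-++ t (map (suc m +_) (upTo (p ∸ 1))) _ ⟩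
    periodDigits (p ∸ 1) ++ [ t (suc m + (p ∸ 1)) ]               ≡⟨ cong (λ k → periodDigits (p ∸ 1) ++ [ t k ]) last≡ ⟩
    periodDigits (p ∸ 1) ++ [ t (m + p) ]                         ∎
    where
    open ≡-Reasoning
    upTo-p : upTo p ≡ upTo (p ∸ 1) ++ [ p ∸ 1 ]
    upTo-p = trans (cong upTo (sym (suc-pred p))) (sym (upTo-∷ʳ (p ∸ 1)))
    last≡ : suc m + (p ∸ 1) ≡ m + p
    last≡ = trans (sym (+-suc m (p ∸ 1))) (cong (m +_) (suc-pred p))

  trailingZeros-periodDigits : (∃ λ i → m < i × i ≤ m + p × t i ≢ 0) →
                               trailingZeros (periodDigits p ++ periodDigits (p ∸ 1)) ≤ p ∸ 1
  trailingZeros-periodDigits (i , m<i , i≤m+p , tᵢ≢0) with i <? m + p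
  ... | no i≮m+p = begin
    trailingZeros (periodDigits p ++ D)        ≡⟨ cong (λ w → trailingZeros (w ++ D)) periodDigits-p ⟩
    trailingZeros ((D ++ [ t (m + p) ]) ++ D)  ≡⟨ cong trailingZeros (++-assoc D _ D) ⟩
    trailingZeros (D ++ t (m + p) ∷ D)         ≤⟨ trailingZeros-++-∷ D D tm+p≢0 ⟩
    length D                                   ≡⟨ length-digits (suc m) (p ∸ 1) ⟩
    p ∸ 1                                      ∎
    where
    open ≤-Reasoning
    D = periodDigits (p ∸ 1)
    tm+p≢0 : t (m + p) ≢ 0
    tm+p≢0 = subst (λ k → t k ≢ 0) (≤-antisym i≤m+p (≮⇒≥ i≮m+p)) tᵢ≢0
  ... | yes i<m+p = begin
    trailingZeros (periodDigits p ++ periodDigits (p ∸ 1)) ≤⟨ trailingZeros-++-∈ (periodDigits p) tᵢ∈ tᵢ≢0 ⟩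
    length (periodDigits (p ∸ 1))                          ≡⟨ length-digits (suc m) (p ∸ 1) ⟩
    p ∸ 1                                                  ∎
    where
    open ≤-Reasoning
    j = i ∸ suc m
    i≡ : suc m + j ≡ i
    i≡ = m+[n∸m]≡n m<i
    i+1≡ : suc i ≡ m + suc (suc j)
    i+1≡ = trans (cong suc (sym i≡)) (sym (trans (+-suc m (suc j)) (cong suc (+-suc m j))))
    j<p∸1 : j < p ∸ 1
    j<p∸1 = pred-mono-≤ (+-cancelˡ-≤ m (suc (suc j)) p (subst (_≤ m + p) i+1≡ i<m+p))
    tᵢ∈ : t i ∈ periodDigits (p ∸ 1)
    tᵢ∈ = subst (λ k → t k ∈ periodDigits (p ∸ 1)) i≡ (∈-map⁺ t (∈-map⁺ (suc m +_) (∈-upTo⁺ j<p∸1)))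

  z-letter : (∃ λ i → m < i × i ≤ m + p × t i ≢ 0) → Letter z
  z-letter nonzero-digit = if-elim Letter (t (m + p) <ᵇ t m) periodic-case preperiodic-case
    where
    open ≤-Reasoning
    periodic-case : suc (trailingZeros (periodDigits p ++ periodDigits (p ∸ 1))) < m + p
    periodic-case = begin-strict
      suc (trailingZeros (periodDigits p ++ periodDigits (p ∸ 1))) ≤⟨ s≤s (trailingZeros-periodDigits nonzero-digit) ⟩
      suc (p ∸ 1)                                                  ≡⟨ suc-pred p ⟩
      p                                                            <⟨ m<n+m p (>-nonZero⁻¹ m) ⟩
      m + p                                                        ∎
    preperiodic-case : suc (trailingZeros (map t (range 1 (m ∸ 1)))) < m + p
    preperiodic-case = begin-strict
      suc (trailingZeros (map t (range 1 (m ∸ 1)))) ≤⟨ s≤s (trailingZeros≤length (map t (range 1 (m ∸ 1)))) ⟩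
      suc (length (map t (range 1 (m ∸ 1))))       ≡⟨ cong suc (length-digits 1 (m ∸ 1)) ⟩
      suc (m ∸ 1)                                   ≡⟨ suc-pred m ⟩
      m                                             <⟨ m<m+p ⟩
      m + p                                         ∎

  z≢0 : z ≢ 0
  z≢0 = if-elim (_≢ 0) (t (m + p) <ᵇ t m) (λ ()) (λ ())

  m∸1<m : m ∸ 1 < m
  m∸1<m = ≤-reflexive (suc-pred m)

  zChain : ℕ → ℕ → List ℕ
  zChain q r = concat (map (λ i → φ^ (r + i * m) base) (upTo q))

  φ*-zChain : ∀ q r → φ* (zChain q r) ≡ zChain q (suc r)
  φ*-zChain q r = trans (concatMap-concat φ (map (λ i → φ^ (r + i * m) base) (upTo q)))
                        (cong concat (sym (map-∘ (upTo q))))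

  base++zChain : ∀ q → base ++ zChain q m ≡ zChain (suc q) 0
  base++zChain q = cong (base ++_) (cong concat (trans (map-upTo (λ i → φ^ (m + i * m) base) q)
                                                      (sym (map-applyUpTo suc (λ i → φ^ (i * m) base) q))))

  zPow-< : ∀ {n} → n < m → zPow n ≡ []
  zPow-< {n} n<m = if-yes (n <? m) n<m

  zPow-0 : ∀ {r} → r < m → zPow (r + 0 * m) ≡ []
  zPow-0 {r} r<m = zPow-< (subst (_< m) (sym (+-identityʳ r)) r<m)

  zPow-unfold : ∀ {r} q → r < m →
    zPow (r + suc q * m) ≡ (if does (p ∣? z) then zChain (suc q) r else φ^ (r + q * m) base)
  zPow-unfold {r} q r<m = begin
    zPow N                                 ≡⟨ if-no (N <? m) (≤⇒≯ m≤N) ⟩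
    choose (N / m) (N % m) (N ∸ m)         ≡⟨ cong (choose (N / m) (N % m)) N∸m≡ ⟩
    choose (N / m) (N % m) (r + q * m)     ≡⟨ cong₂ (λ k l → choose k l (r + q * m)) N/m≡ N%m≡ ⟩
    choose (suc q) r (r + q * m)           ∎
    where
    open ≡-Reasoning
    choose : ℕ → ℕ → ℕ → List ℕ
    choose k l e = if does (p ∣? z) then zChain k l else φ^ e base
    N = r + suc q * m
    m≤N : m ≤ N
    m≤N = ≤-trans (m≤m+n m (q * m)) (m≤n+m (m + q * m) r)
    N%m≡ : N % m ≡ r
    N%m≡ = trans ([m+kn]%n≡m%n r (suc q) m) (m<n⇒m%n≡m r<m)
    N/m≡ : N / m ≡ suc q
    N/m≡ = trans (+-distrib-/-∣ʳ r (n∣m*n (suc q))) (cong₂ _+_ (m<n⇒m/n≡0 r<m) (m*n/n≡m (suc q) m))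
    swap : ∀ r m k → r + (m + k) ≡ m + (r + k)
    swap = solve-∀
    N∸m≡ : N ∸ m ≡ r + q * m
    N∸m≡ = trans (cong (_∸ m) (swap r m (q * m))) (m+n∸m≡n m (r + q * m))

  zPow-chain : ∀ {r} q → r < m → p ∣ z → zPow (r + q * m) ≡ zChain q r
  zPow-chain zero    r<m _   = zPow-0 r<m
  zPow-chain (suc q) r<m p∣z = trans (zPow-unfold q r<m) (if-yes (p ∣? z) p∣z)

  zPow-single : ∀ {r} q → r < m → ¬ p ∣ z → zPow (r + suc q * m) ≡ φ^ (r + q * m) base
  zPow-single q r<m p∤z = trans (zPow-unfold q r<m) (if-no (p ∣? z) p∤z)

  φ*-zPow : ∀ q {r} → suc r < m → φ* (zPow (r + q * m)) ≡ zPow (suc r + q * m)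
  φ*-zPow q {r} sr<m = by-cases q (p ∣? z)
    where
    r<m : r < m
    r<m = <-trans (n<1+n r) sr<m
    by-cases : ∀ q → Dec (p ∣ z) → φ* (zPow (r + q * m)) ≡ zPow (suc r + q * m)
    by-cases q       (yes p∣z) = trans (cong φ* (zPow-chain q r<m p∣z)) (trans (φ*-zChain q r) (sym (zPow-chain q sr<m p∣z)))
    by-cases zero    (no _)    = trans (cong φ* (zPow-0 r<m)) (sym (zPow-0 sr<m))
    by-cases (suc q) (no p∤z)  = trans (cong φ* (zPow-single q r<m p∤z)) (sym (zPow-single q sr<m p∤z))

  zPow-boundary-chain : ∀ q → p ∣ z ⊎ q ≡ 0 → base ++ φ* (zPow (m ∸ 1 + q * m)) ≡ zPow (suc q * m)
  zPow-boundary-chain q p∣z⊎q≡0 = by-cases (p ∣? z) p∣z⊎q≡0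
    where
    open ≡-Reasoning
    by-cases : Dec (p ∣ z) → p ∣ z ⊎ q ≡ 0 → base ++ φ* (zPow (m ∸ 1 + q * m)) ≡ zPow (suc q * m)
    by-cases (yes p∣z) _ = begin
      base ++ φ* (zPow (m ∸ 1 + q * m)) ≡⟨ cong (λ w → base ++ φ* w) (zPow-chain q m∸1<m p∣z) ⟩
      base ++ φ* (zChain q (m ∸ 1))     ≡⟨ cong (base ++_) (φ*-zChain q (m ∸ 1)) ⟩
      base ++ zChain q (suc (m ∸ 1))    ≡⟨ cong (λ r → base ++ zChain q r) (suc-pred m) ⟩
      base ++ zChain q m                ≡⟨ base++zChain q ⟩
      zChain (suc q) 0                  ≡⟨ sym (zPow-chain (suc q) (>-nonZero⁻¹ m) p∣z) ⟩
      zPow (suc q * m)                  ∎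
    by-cases (no p∤z) (inj₁ p∣z)  = contradiction p∣z p∤z
    by-cases (no p∤z) (inj₂ refl) = begin
      base ++ φ* (zPow (m ∸ 1 + 0 * m)) ≡⟨ cong (λ w → base ++ φ* w) (zPow-0 m∸1<m) ⟩
      base ++ []                        ≡⟨ ++-identityʳ base ⟩
      base                              ≡⟨ sym (zPow-single 0 (>-nonZero⁻¹ m) p∤z) ⟩
      zPow (1 * m)                      ∎

  zPow-boundary-single : ∀ q → ¬ p ∣ z → 1 ≤ q → φ* (zPow (m ∸ 1 + q * m)) ≡ zPow (suc q * m)
  zPow-boundary-single (suc q) p∤z _ = begin
    φ* (zPow (m ∸ 1 + suc q * m))     ≡⟨ cong φ* (zPow-single q m∸1<m p∤z) ⟩
    φ^ (suc (m ∸ 1) + q * m) base     ≡⟨ cong (λ k → φ^ (k + q * m) base) (suc-pred m) ⟩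
    φ^ (m + q * m) base               ≡⟨ sym (zPow-single (suc q) (>-nonZero⁻¹ m) p∤z) ⟩
    zPow (suc (suc q) * m)            ∎
    where open ≡-Reasoning

  -- Iterating f

  fPrefix fSuffix : ℕ → BS → List ℕ
  fPrefix zero    B = []
  fPrefix (suc n) B = fL (BS.la (fIter n B)) (BS.lb (fIter n B)) ++ φ* (fPrefix n B)
  fSuffix zero    B = []
  fSuffix (suc n) B = φ* (fSuffix n B) ++ fR (BS.rc (fIter n B)) (BS.rd (fIter n B))

  fIter-word : ∀ n B → BS.word (fIter n B) ≡ fPrefix n B ++ φ^ n (BS.word B) ++ fSuffix n B
  fIter-word zero    B = sym (++-identityʳ (BS.word B))
  fIter-word (suc n) B = begin
    L ++ φ* (BS.word (fIter n B)) ++ R  ≡⟨ cong (λ w → L ++ φ* w ++ R) (fIter-word n B) ⟩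
    L ++ φ* (P ++ V ++ S) ++ R          ≡⟨ cong (λ w → L ++ w ++ R) φ*-++₃ ⟩
    L ++ (φ* P ++ φ* V ++ φ* S) ++ R    ≡⟨ cong (L ++_) (++-assoc₃ (φ* P) (φ* V) (φ* S) R) ⟩
    L ++ φ* P ++ φ* V ++ φ* S ++ R      ≡⟨ sym (++-assoc L (φ* P) _) ⟩
    (L ++ φ* P) ++ φ* V ++ φ* S ++ R    ∎
    where
    open ≡-Reasoning
    Bₙ = fIter n B
    L = fL (BS.la Bₙ) (BS.lb Bₙ)
    R = fR (BS.rc Bₙ) (BS.rd Bₙ)
    P = fPrefix n B
    V = φ^ n (BS.word B)
    S = fSuffix n B
    φ*-++₃ : φ* (P ++ V ++ S) ≡ φ* P ++ φ* V ++ φ* S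
    φ*-++₃ = trans (concatMap-++ φ P (V ++ S)) (cong (φ* P ++_) (concatMap-++ φ V S))
    ++-assoc₃ : ∀ (A B C D : List ℕ) → (A ++ B ++ C) ++ D ≡ A ++ B ++ C ++ D
    ++-assoc₃ A B C D = trans (++-assoc A (B ++ C) D) (cong (A ++_) (++-assoc B C D))

  -- Right extensions

  fork-φ* : ∀ {u x y w w′ u′ x′ y′} → Fork u x y w w′ → Fork u′ x′ y′ (φ* [ x ]) (φ* [ y ]) →
            Fork (φ* u ++ u′) x′ y′ (φ* w) (φ* w′)
  fork-φ* {u} {x} {y} {u′ = u′} {x′} {y′} (fork rest refl refl) (fork rest′ φx≡ φy≡) =
    fork (rest′ ++ φ* rest) left≡ right≡
    where
    open ≡-Reasoning
    left≡ : φ* (u ++ [ x ]) ≡ (φ* u ++ u′) ++ [ x′ ]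
    left≡ = begin
      φ* (u ++ [ x ])         ≡⟨ concatMap-++ φ u [ x ] ⟩
      φ* u ++ φ* [ x ]        ≡⟨ cong (φ* u ++_) φx≡ ⟩
      φ* u ++ u′ ++ [ x′ ]    ≡⟨ sym (++-assoc (φ* u) u′ [ x′ ]) ⟩
      (φ* u ++ u′) ++ [ x′ ]  ∎
    right≡ : φ* (u ++ [ y ] ++ rest) ≡ (φ* u ++ u′) ++ y′ ∷ rest′ ++ φ* rest
    right≡ = begin
      φ* (u ++ [ y ] ++ rest)                ≡⟨ concatMap-++ φ u ([ y ] ++ rest) ⟩
      φ* u ++ φ* ([ y ] ++ rest)             ≡⟨ cong (φ* u ++_) (concatMap-++ φ [ y ] rest) ⟩
      φ* u ++ φ* [ y ] ++ φ* rest            ≡⟨ cong (λ w → φ* u ++ w ++ φ* rest) φy≡ ⟩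
      φ* u ++ (u′ ++ y′ ∷ rest′) ++ φ* rest  ≡⟨ cong (φ* u ++_) (++-assoc u′ (y′ ∷ rest′) (φ* rest)) ⟩
      φ* u ++ u′ ++ y′ ∷ rest′ ++ φ* rest    ≡⟨ sym (++-assoc (φ* u) u′ _) ⟩
      (φ* u ++ u′) ++ y′ ∷ rest′ ++ φ* rest  ∎

  fork-fR : ∀ {x y x′ y′ rest} s → x′ ≢ y′ →
            φ x ≡ replicate s 0 ++ [ x′ ] → φ y ≡ replicate s 0 ++ y′ ∷ rest →
            Fork (fR x y) x′ y′ (φ* [ x ]) (φ* [ y ])
  fork-fR {x} {y} {x′} {y′} {rest} s x′≢y′ φx≡ φy≡ =
    fork rest (trans (++-identityʳ (φ x)) (trans φx≡ (cong (_++ [ x′ ]) (sym fR≡))))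
              (trans (++-identityʳ (φ y)) (trans φy≡ (cong (_++ y′ ∷ rest) (sym fR≡))))
    where
    fR≡ : fR x y ≡ replicate s 0
    fR≡ = lcp-fork x′≢y′ (fork rest φx≡ φy≡)

  record RightInvariant (c d n : ℕ) (u : List ℕ) (x y : ℕ) : Set where
    constructor rightInvariant
    field
      fork-φⁿ  : Fork u x y (φ^ n [ c ]) (φ^ n [ d ])
      x≡c⊕n    : x ≡ c ⊕ n
      y-letter : Letter y
      ordered  : tFrom x ≺ tFrom y

  rc-fStep : ∀ B → tIdx (suc (BS.rc B)) ≤ tIdx (suc (BS.rd B)) → BS.rc (fStep B) ≡ BS.rc B ⊕ 1
  rc-fStep (bs _ _ x y _) s≤s′ = cong (λ k → headD 0 (replicate k 0 ++ [ x ⊕ 1 ])) (begin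
    tIdx (suc x) ∸ tIdx (suc x) ⊓ tIdx (suc y) ≡⟨ cong (tIdx (suc x) ∸_) (m≤n⇒m⊓n≡m s≤s′) ⟩
    tIdx (suc x) ∸ tIdx (suc x)                ≡⟨ n∸n≡0 (tIdx (suc x)) ⟩
    0                                          ∎)
    where open ≡-Reasoning

  rd-fStep-< : ∀ B → tIdx (suc (BS.rc B)) < tIdx (suc (BS.rd B)) → BS.rd (fStep B) ≡ 0
  rd-fStep-< (bs _ _ x y _) s<s′ = cong (λ k → headD 0 (replicate k 0 ++ [ y ⊕ 1 ])) (begin
    tIdx (suc y) ∸ tIdx (suc x) ⊓ tIdx (suc y) ≡⟨ cong (tIdx (suc y) ∸_) (m≤n⇒m⊓n≡m (<⇒≤ s<s′)) ⟩
    tIdx (suc y) ∸ tIdx (suc x)                ≡⟨ +-∸-assoc 1 s<s′ ⟩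
    suc (tIdx (suc y) ∸ suc (tIdx (suc x)))    ∎)
    where open ≡-Reasoning

  rd-fStep-≡ : ∀ B → tIdx (suc (BS.rc B)) ≡ tIdx (suc (BS.rd B)) → BS.rd (fStep B) ≡ BS.rd B ⊕ 1
  rd-fStep-≡ (bs _ _ x y _) s≡s′ = cong (λ k → headD 0 (replicate k 0 ++ [ y ⊕ 1 ])) (begin
    tIdx (suc y) ∸ tIdx (suc x) ⊓ tIdx (suc y) ≡⟨ cong (tIdx (suc y) ∸_) (m≤n⇒m⊓n≡m (≤-reflexive s≡s′)) ⟩
    tIdx (suc y) ∸ tIdx (suc x)                ≡⟨ cong (_∸ tIdx (suc x)) (sym s≡s′) ⟩
    tIdx (suc x) ∸ tIdx (suc x)                ≡⟨ n∸n≡0 (tIdx (suc x)) ⟩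
    0                                          ∎)
    where open ≡-Reasoning

  right-compose : ∀ {c d n u x y u′ x′ y′} → RightInvariant c d n u x y → RightInvariant x y 1 u′ x′ y′ →
                  RightInvariant c d (suc n) (φ* u ++ u′) x′ y′
  right-compose {c} {n = n} (rightInvariant fork₁ x≡c⊕n _ _) (rightInvariant fork₂ x′≡x⊕1 y′-letter ordered) =
    rightInvariant (fork-φ* fork₁ fork₂) (trans x′≡x⊕1 (trans (cong (_⊕ 1) x≡c⊕n) (⊕-suc c n))) y′-letter ordered

  module _ (parry : ∀ i → 2 ≤ i → (λ j → tIdx (i + j)) ≺ (λ j → tIdx (1 + j))) where

    right-step : ∀ B → let x = BS.rc B; y = BS.rd B in Letter x → Letter y → tFrom x ≺ tFrom y →
                 RightInvariant x y 1 (fR x y) (BS.rc (fStep B)) (BS.rd (fStep B))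
    right-step B@(bs _ _ x y _) x<m+p y<m+p (zero , _ , lt) =
      subst₂ (RightInvariant x y 1 (fR x y)) (sym (rc-fStep B (<⇒≤ s<s′))) (sym (rd-fStep-< B s<s′))
        (rightInvariant (fork-fR s (⊕1≢0 x<m+p) refl φy≡) refl 0<m+p
                        (tFrom-≺-tFrom0 parry (n≢0⇒n>0 (⊕1≢0 x<m+p))))
      where
      open ≡-Reasoning
      s = tIdx (suc x)
      s′ = tIdx (suc y)
      s<s′ : s < s′
      s<s′ = subst₂ _<_ (tFrom-head x) (tFrom-head y) lt
      k = s′ ∸ suc s
      s′≡s+1+k : s′ ≡ s + suc k
      s′≡s+1+k = sym (trans (+-suc s k) (m+[n∸m]≡n s<s′))
      φy≡ : φ y ≡ replicate s 0 ++ 0 ∷ replicate k 0 ++ [ y ⊕ 1 ]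
      φy≡ = begin
        replicate s′ 0 ++ [ y ⊕ 1 ]                   ≡⟨ cong (λ i → replicate i 0 ++ [ y ⊕ 1 ]) s′≡s+1+k ⟩
        replicate (s + suc k) 0 ++ [ y ⊕ 1 ]          ≡⟨ cong (_++ [ y ⊕ 1 ]) (replicate-+-∷ s k 0) ⟩
        (replicate s 0 ++ 0 ∷ replicate k 0) ++ [ y ⊕ 1 ] ≡⟨ ++-assoc (replicate s 0) _ [ y ⊕ 1 ] ⟩
        replicate s 0 ++ 0 ∷ replicate k 0 ++ [ y ⊕ 1 ] ∎
    right-step B@(bs _ _ x y _) x<m+p y<m+p (suc k , agree , lt) =
      subst₂ (RightInvariant x y 1 (fR x y)) (sym (rc-fStep B (≤-reflexive s≡s′))) (sym (rd-fStep-≡ B s≡s′))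
        (rightInvariant (fork-fR (tIdx (suc x)) (tFrom-≺⇒≢ ordered) refl φy≡) refl (⊕-letter y 1) ordered)
      where
      s≡s′ : tIdx (suc x) ≡ tIdx (suc y)
      s≡s′ = trans (sym (tFrom-head x)) (trans (agree 0 z<s) (tFrom-head y))
      φy≡ : φ y ≡ replicate (tIdx (suc x)) 0 ++ [ y ⊕ 1 ]
      φy≡ = cong (λ i → replicate i 0 ++ [ y ⊕ 1 ]) (sym s≡s′)
      ordered : tFrom (x ⊕ 1) ≺ tFrom (y ⊕ 1)
      ordered = ≺-cong (sym ∘ tFrom-⊕1 x<m+p) (sym ∘ tFrom-⊕1 y<m+p) (k , (λ j j<k → agree (suc j) (s<s j<k)) , lt)

    fSuffix-invariant : ∀ {a b c d v} → Letter c → Letter d → tFrom c ≺ tFrom d → ∀ n →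
      let Bₙ = fIter n (bs a b c d v) in RightInvariant c d n (fSuffix n (bs a b c d v)) (BS.rc Bₙ) (BS.rd Bₙ)
    fSuffix-invariant c<m+p d<m+p c≺d zero = rightInvariant (fork [] refl refl) (sym (⊕-identityʳ c<m+p)) d<m+p c≺d
    fSuffix-invariant {a} {b} {c} {d} {v} c<m+p d<m+p c≺d (suc n) with fSuffix-invariant {a} {b} {c} {d} {v} c<m+p d<m+p c≺d n
    ... | inv@(rightInvariant _ x≡c⊕n y-letter ordered) =
      right-compose inv (right-step (fIter n (bs a b c d v)) (subst Letter (sym x≡c⊕n) (⊕-letter c n)) y-letter ordered)

    fSuffix≡lcp : ∀ {a b c d v} → Letter c → Letter d → tFrom c ≺ tFrom d → ∀ n →
      lcp (φ^ n [ c ]) (φ^ n [ d ]) ≡ fSuffix n (bs a b c d v) × φ^ n [ c ] ≡ fSuffix n (bs a b c d v) ++ [ c ⊕ n ]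
    fSuffix≡lcp {a} {b} {c} {d} {v} c<m+p d<m+p c≺d n with fSuffix-invariant {a} {b} {c} {d} {v} c<m+p d<m+p c≺d n
    ... | rightInvariant φⁿ-fork x≡c⊕n _ ordered =
      lcp-fork (tFrom-≺⇒≢ ordered) φⁿ-fork ,
      trans (Fork.left≡ φⁿ-fork) (cong (λ k → fSuffix n (bs a b c d v) ++ [ k ]) x≡c⊕n)

  -- Left extensions

  SpecialPair : ℕ → ℕ → Set
  SpecialPair x y = (x ≡ m ∸ 1 × y ≡ m + p ∸ 1) ⊎ (y ≡ m ∸ 1 × x ≡ m + p ∸ 1)

  -- does (special? x y) is the test `special` inside fStep, so if-yes and if-no evaluate it.
  special? : ∀ x y → Dec (SpecialPair x y)
  special? x y = ((x ≟ m ∸ 1) ×-dec (y ≟ m + p ∸ 1)) ⊎-dec ((y ≟ m ∸ 1) ×-dec (x ≟ m + p ∸ 1))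

  nextA nextB : ℕ → ℕ → ℕ
  nextA a b = BS.la (fStep (bs a b 0 0 []))
  nextB a b = BS.lb (fStep (bs a b 0 0 []))

  leftLetter : ℕ → ℕ
  leftLetter x = if tmin <ᵇ tIdx (suc x) then 0 else z

  ordinary-next : ∀ {x y} (P : ℕ → ℕ → Set) → ¬ SpecialPair x y → P (x ⊕ 1) (y ⊕ 1) → P (nextA x y) (nextB x y)
  ordinary-next {x} {y} P ¬sp = subst₂ P (sym (if-no (special? x y) ¬sp)) (sym (if-no (special? x y) ¬sp))

  special-next : ∀ {x y} (P : ℕ → ℕ → Set) → SpecialPair x y → P (leftLetter x) (leftLetter y) → P (nextA x y) (nextB x y)
  special-next {x} {y} P sp = subst₂ P (sym (if-yes (special? x y) sp)) (sym (if-yes (special? x y) sp))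

  DistinctLetters : ℕ → ℕ → Set
  DistinctLetters x y = Letter x × Letter y × x ≢ y

  suc[m+p∸1]≡m+p : suc (m + p ∸ 1) ≡ m + p
  suc[m+p∸1]≡m+p = suc-pred (m + p) {{>-nonZero 0<m+p}}

  m+p∸1≡m∸1+p : m + p ∸ 1 ≡ m ∸ 1 + p
  m+p∸1≡m∸1+p = +-∸-comm p (>-nonZero⁻¹ m)

  m∸1≤m+p∸1 : m ∸ 1 ≤ m + p ∸ 1
  m∸1≤m+p∸1 = ∸-monoˡ-≤ 1 (m≤m+n m p)

  m∸1⊕1 : (m ∸ 1) ⊕ 1 ≡ m
  m∸1⊕1 = trans (⊕1-inner (subst (_< m + p) (sym (suc-pred m)) m<m+p)) (suc-pred m)

  m+p∸1⊕1 : (m + p ∸ 1) ⊕ 1 ≡ m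
  m+p∸1⊕1 = ⊕1-top suc[m+p∸1]≡m+p

  tIdx-m : tIdx (suc (m ∸ 1)) ≡ t m
  tIdx-m = trans (cong tIdx (suc-pred m)) (tIdx-≤ (m≤m+n m p))

  tIdx-m+p : tIdx (suc (m + p ∸ 1)) ≡ t (m + p)
  tIdx-m+p = trans (cong tIdx suc[m+p∸1]≡m+p) (tIdx-≤ ≤-refl)

  ⊕1-injective : ∀ {x y} → DistinctLetters x y → x ⊕ 1 ≡ y ⊕ 1 → SpecialPair x y
  ⊕1-injective (x<m+p , y<m+p , x≢y) eq with ⊕1-view x<m+p | ⊕1-view y<m+p
  ... | inj₁ (_ , x⊕1≡sx)      | inj₁ (_ , y⊕1≡sy)      =
    contradiction (suc-injective (trans (sym x⊕1≡sx) (trans eq y⊕1≡sy))) x≢y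
  ... | inj₁ (_ , x⊕1≡sx)      | inj₂ (sy≡m+p , y⊕1≡m) =
    inj₁ (cong pred (trans (sym x⊕1≡sx) (trans eq y⊕1≡m)) , cong pred sy≡m+p)
  ... | inj₂ (sx≡m+p , x⊕1≡m) | inj₁ (_ , y⊕1≡sy)      =
    inj₂ (cong pred (trans (sym y⊕1≡sy) (trans (sym eq) x⊕1≡m)) , cong pred sx≡m+p)
  ... | inj₂ (sx≡m+p , _)      | inj₂ (sy≡m+p , _)      =
    contradiction (suc-injective (trans sx≡m+p (sym sy≡m+p))) x≢y

  ordinary-distinct : ∀ {x y} → DistinctLetters x y → ¬ SpecialPair x y → DistinctLetters (x ⊕ 1) (y ⊕ 1)
  ordinary-distinct {x} {y} distinct ¬sp = ⊕-letter x 1 , ⊕-letter y 1 , ¬sp ∘ ⊕1-injective distinct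

  reverse-φ : ∀ x → reverse (φ x) ≡ x ⊕ 1 ∷ replicate (tIdx (suc x)) 0
  reverse-φ x = trans (reverse-++ (replicate (tIdx (suc x)) 0) [ x ⊕ 1 ]) (cong (x ⊕ 1 ∷_) (reverse-replicate _ 0))

  fL-≢ : ∀ {x y} → x ⊕ 1 ≢ y ⊕ 1 → fL x y ≡ []
  fL-≢ {x} {y} x⊕1≢y⊕1 =
    cong reverse (trans (cong₂ lcp (reverse-φ x) (reverse-φ y)) (if-no (x ⊕ 1 ≟ y ⊕ 1) x⊕1≢y⊕1))

  fL-m : ∀ {x y} → x ⊕ 1 ≡ m → y ⊕ 1 ≡ m → fL x y ≡ replicate (tIdx (suc x) ⊓ tIdx (suc y)) 0 ++ [ m ]
  fL-m {x} {y} x⊕1≡m y⊕1≡m = begin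
    reverse (lcp (reverse (φ x)) (reverse (φ y)))
      ≡⟨ cong reverse (cong₂ lcp (reverse-φ x) (reverse-φ y)) ⟩
    reverse (lcp (x ⊕ 1 ∷ zeros s) (y ⊕ 1 ∷ zeros s′))
      ≡⟨ cong reverse (if-yes (x ⊕ 1 ≟ y ⊕ 1) (trans x⊕1≡m (sym y⊕1≡m))) ⟩
    reverse (x ⊕ 1 ∷ lcp (zeros s) (zeros s′))
      ≡⟨ cong₂ (λ k w → reverse (k ∷ w)) x⊕1≡m (lcp-replicate s s′ 0) ⟩
    reverse (m ∷ zeros (s ⊓ s′))
      ≡⟨ unfold-reverse m (zeros (s ⊓ s′)) ⟩
    reverse (zeros (s ⊓ s′)) ++ [ m ]
      ≡⟨ cong (_++ [ m ]) (reverse-replicate (s ⊓ s′) 0) ⟩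
    zeros (s ⊓ s′) ++ [ m ]
      ∎
    where
    open ≡-Reasoning
    zeros : ℕ → List ℕ
    zeros k = replicate k 0
    s = tIdx (suc x)
    s′ = tIdx (suc y)

  ordinary-fL : ∀ {x y} → DistinctLetters x y → ¬ SpecialPair x y → fL x y ≡ []
  ordinary-fL distinct ¬sp = fL-≢ (¬sp ∘ ⊕1-injective distinct)

  special-fL : ∀ {x y} → SpecialPair x y → fL x y ≡ base
  special-fL (inj₁ (refl , refl)) =
    trans (fL-m m∸1⊕1 m+p∸1⊕1) (cong (λ k → replicate k 0 ++ [ m ]) (cong₂ _⊓_ tIdx-m tIdx-m+p))
  special-fL (inj₂ (refl , refl)) =
    trans (fL-m m+p∸1⊕1 m∸1⊕1) (cong (λ k → replicate k 0 ++ [ m ]) (trans (cong₂ _⊓_ tIdx-m+p tIdx-m) (⊓-comm _ _)))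

  special-≡ₚ : ∀ {x y} → SpecialPair x y → x ≡ₚ y
  special-≡ₚ (inj₁ (refl , refl)) = sym (trans (cong (_% p) m+p∸1≡m∸1+p) ([m+n]%n≡m%n (m ∸ 1) p))
  special-≡ₚ (inj₂ (refl , refl)) = trans (cong (_% p) m+p∸1≡m∸1+p) ([m+n]%n≡m%n (m ∸ 1) p)

  special-⊓ : ∀ {x y} → SpecialPair x y → x ⊓ y ≡ m ∸ 1
  special-⊓ (inj₁ (refl , refl)) = m≤n⇒m⊓n≡m m∸1≤m+p∸1
  special-⊓ (inj₂ (refl , refl)) = m≥n⇒m⊓n≡n m∸1≤m+p∸1

  congruent-below-m : ∀ {x y} → x < y → Letter y → x ≡ₚ y → x < m
  congruent-below-m x<y y<m+p x≡ₚy = +-cancelʳ-< p _ m (≤-<-trans (≡ₚ-gap x<y x≡ₚy) y<m+p)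

  congruent-top : ∀ {x y} → x < y → Letter y → x ≡ₚ y → x ≡ m ∸ 1 → y ≡ m + p ∸ 1
  congruent-top {y = y} x<y y<m+p x≡ₚy refl =
    ≤-antisym (suc[m]≤n⇒m≤pred[n] y<m+p) (subst (_≤ y) (sym m+p∸1≡m∸1+p) (≡ₚ-gap x<y x≡ₚy))

  congruent-⊓<m : ∀ {x y} → DistinctLetters x y → x ≡ₚ y → x ⊓ y < m
  congruent-⊓<m {x} {y} (x<m+p , y<m+p , x≢y) x≡ₚy with <-cmp x y
  ... | tri< x<y _ _ = subst (_< m) (sym (m≤n⇒m⊓n≡m (<⇒≤ x<y))) (congruent-below-m x<y y<m+p x≡ₚy)
  ... | tri≈ _ x≡y _ = contradiction x≡y x≢y
  ... | tri> _ _ y<x = subst (_< m) (sym (m≥n⇒m⊓n≡n (<⇒≤ y<x))) (congruent-below-m y<x x<m+p (sym x≡ₚy))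

  congruent-special : ∀ {x y} → DistinctLetters x y → x ≡ₚ y → x ⊓ y ≡ m ∸ 1 → SpecialPair x y
  congruent-special {x} {y} (x<m+p , y<m+p , x≢y) x≡ₚy ⊓≡ with <-cmp x y
  ... | tri< x<y _ _ = inj₁ (x≡ , congruent-top x<y y<m+p x≡ₚy x≡)
    where x≡ = trans (sym (m≤n⇒m⊓n≡m (<⇒≤ x<y))) ⊓≡
  ... | tri≈ _ x≡y _ = contradiction x≡y x≢y
  ... | tri> _ _ y<x = inj₂ (y≡ , congruent-top y<x x<m+p (sym x≡ₚy) y≡)
    where y≡ = trans (sym (m≥n⇒m⊓n≡n (<⇒≤ y<x))) ⊓≡

  ⊓-⊕1 : ∀ {x y r} → DistinctLetters x y → x ⊓ y ≡ r → suc r < m → (x ⊕ 1) ⊓ (y ⊕ 1) ≡ suc r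
  ⊓-⊕1 {x} {y} {r} (x<m+p , y<m+p , _) ⊓≡r sr<m with ≤-total x y
  ... | inj₁ x≤y = trans (cong (_⊓ (y ⊕ 1)) (trans (cong (_⊕ 1) x≡r) r⊕1≡sr))
                         (m≤n⇒m⊓n≡m (⊕1-≥ y<m+p (subst (_≤ y) x≡r x≤y) (<⇒≤ sr<m)))
    where
    x≡r = trans (sym (m≤n⇒m⊓n≡m x≤y)) ⊓≡r
    r⊕1≡sr = ⊕1-inner (<-trans sr<m m<m+p)
  ... | inj₂ y≤x = trans (cong ((x ⊕ 1) ⊓_) (trans (cong (_⊕ 1) y≡r) r⊕1≡sr))
                         (m≥n⇒m⊓n≡n (⊕1-≥ x<m+p (subst (_≤ x) y≡r y≤x) (<⇒≤ sr<m)))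
    where
    y≡r = trans (sym (m≥n⇒m⊓n≡n y≤x)) ⊓≡r
    r⊕1≡sr = ⊕1-inner (<-trans sr<m m<m+p)

  ZeroZPair : ℕ → ℕ → Set
  ZeroZPair x y = (x ≡ 0 × y ≡ z) ⊎ (x ≡ z × y ≡ 0)

  zeroZ-⊓ : ∀ {x y} → ZeroZPair x y → x ⊓ y ≡ 0
  zeroZ-⊓ (inj₁ (refl , refl)) = refl
  zeroZ-⊓ (inj₂ (refl , refl)) = ⊓-zeroʳ z

  zeroZ-≡ₚ⇔ : ∀ {x y} → ZeroZPair x y → x ≡ₚ y ⇔ p ∣ z
  zeroZ-≡ₚ⇔ (inj₁ (refl , refl)) = %≡%⇔∣∣-∣ p 0 z
  zeroZ-≡ₚ⇔ (inj₂ (refl , refl)) = mk⇔ (to ∘ sym) (sym ∘ from)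
    where open Equivalence (%≡%⇔∣∣-∣ p 0 z)

  leftLetter-0 : ∀ {x} → tmin < tIdx (suc x) → leftLetter x ≡ 0
  leftLetter-0 {x} lt = if-yes (tmin <? tIdx (suc x)) lt

  leftLetter-z : ∀ {x} → ¬ tmin < tIdx (suc x) → leftLetter x ≡ z
  leftLetter-z {x} ≮ = if-no (tmin <? tIdx (suc x)) ≮

  module _ (nonzero-digit : ∃ λ i → m < i × i ≤ m + p × t i ≢ 0) (tm≢tm+p : t m ≢ t (m + p)) where

    zeroZ-distinct : ∀ {x y} → ZeroZPair x y → DistinctLetters x y
    zeroZ-distinct (inj₁ (refl , refl)) = 0<m+p , z-letter nonzero-digit , z≢0 ∘ sym
    zeroZ-distinct (inj₂ (refl , refl)) = z-letter nonzero-digit , 0<m+p , z≢0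

    leftLetters-special : ZeroZPair (leftLetter (m ∸ 1)) (leftLetter (m + p ∸ 1))
    leftLetters-special with <-cmp (t m) (t (m + p))
    ... | tri< tm<tm+p _ _ = inj₂ (leftLetter-z (<-irrefl refl ∘ subst₂ _<_ tmin≡tm tIdx-m) ,
                                   leftLetter-0 (subst₂ _<_ (sym tmin≡tm) (sym tIdx-m+p) tm<tm+p))
      where tmin≡tm = m≤n⇒m⊓n≡m (<⇒≤ tm<tm+p)
    ... | tri≈ _ tm≡tm+p _ = contradiction tm≡tm+p tm≢tm+p
    ... | tri> _ _ tm+p<tm = inj₁ (leftLetter-0 (subst₂ _<_ (sym tmin≡tm+p) (sym tIdx-m) tm+p<tm) ,
                                   leftLetter-z (<-irrefl refl ∘ subst₂ _<_ tmin≡tm+p tIdx-m+p))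
      where tmin≡tm+p = m≥n⇒m⊓n≡n (<⇒≤ tm+p<tm)

    special-zeroZ : ∀ {x y} → SpecialPair x y → ZeroZPair (nextA x y) (nextB x y)
    special-zeroZ sp@(inj₁ (refl , refl)) = special-next ZeroZPair sp leftLetters-special
    special-zeroZ sp@(inj₂ (refl , refl)) = special-next ZeroZPair sp (swap leftLetters-special)
      where
      swap : ∀ {x y} → ZeroZPair x y → ZeroZPair y x
      swap (inj₁ (x≡0 , y≡z)) = inj₂ (y≡z , x≡0)
      swap (inj₂ (x≡z , y≡0)) = inj₁ (y≡0 , x≡z)

    -- The left letters after n steps, where N = n + min{a, b} = r + q m.  Aligned: congruent,
    -- with minimum r, so that r = m − 1 is the special pair.  Drifting: after the pair {0, z}
    -- with p ∤ z, never congruent again.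
    data Phase (q r x y : ℕ) : Set where
      aligned  : p ∣ z ⊎ q ≡ 0 → x ≡ₚ y → x ⊓ y ≡ r → Phase q r x y
      drifting : ¬ p ∣ z → 1 ≤ q → ¬ x ≡ₚ y → Phase q r x y

    record LeftState (N x y : ℕ) : Set where
      constructor leftState
      field
        q r      : ℕ
        N≡       : N ≡ r + q * m
        r<m      : r < m
        distinct : DistinctLetters x y
        phase    : Phase q r x y

    LeftStep : ℕ → ℕ → ℕ → Set
    LeftStep N x y = LeftState (suc N) (nextA x y) (nextB x y) × fL x y ++ φ* (zPow N) ≡ zPow (suc N)

    incongruent-next : ∀ {x y} → DistinctLetters x y → ¬ x ≡ₚ y →
      (DistinctLetters (nextA x y) (nextB x y) × ¬ nextA x y ≡ₚ nextB x y) × fL x y ≡ []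
    incongruent-next distinct@(x<m+p , y<m+p , _) x≢ₚy =
      ordinary-next (λ x′ y′ → DistinctLetters x′ y′ × ¬ x′ ≡ₚ y′) ¬sp
        (ordinary-distinct distinct ¬sp , ⊕1-pres-≢ₚ x<m+p y<m+p x≢ₚy) ,
      ordinary-fL distinct ¬sp
      where ¬sp = x≢ₚy ∘ special-≡ₚ

    zeroZ-state : ∀ {x y} q → ZeroZPair x y → p ∣ z ⊎ q ≡ 0 → LeftState (suc q * m) x y
    zeroZ-state q zz p∣z⊎q≡0 = leftState (suc q) 0 refl (>-nonZero⁻¹ m) (zeroZ-distinct zz) (phase (p ∣? z) p∣z⊎q≡0)
      where
      open Equivalence (zeroZ-≡ₚ⇔ zz)
      phase : Dec (p ∣ z) → p ∣ z ⊎ q ≡ 0 → Phase (suc q) 0 _ _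
      phase (yes p∣z) _ = aligned (inj₁ p∣z) (from p∣z) (zeroZ-⊓ zz)
      phase (no p∤z)  _ = drifting p∤z (s≤s z≤n) (p∤z ∘ to)

    aligned-inner : ∀ {q r x y} → DistinctLetters x y → p ∣ z ⊎ q ≡ 0 → x ≡ₚ y → x ⊓ y ≡ r → suc r < m →
                    LeftStep (r + q * m) x y
    aligned-inner {q} {r} distinct@(x<m+p , y<m+p , _) p∣z⊎q≡0 x≡ₚy ⊓≡r sr<m =
      ordinary-next (LeftState (suc (r + q * m))) ¬sp
        (leftState q (suc r) refl sr<m (ordinary-distinct distinct ¬sp)
                   (aligned p∣z⊎q≡0 (⊕1-pres-≡ₚ x<m+p y<m+p x≡ₚy) (⊓-⊕1 distinct ⊓≡r sr<m))) ,
      trans (cong (_++ φ* (zPow (r + q * m))) (ordinary-fL distinct ¬sp)) (φ*-zPow q sr<m)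
      where
      ¬sp : ¬ SpecialPair _ _
      ¬sp sp = <-irrefl (trans (cong suc (trans (sym ⊓≡r) (special-⊓ sp))) (suc-pred m)) sr<m

    aligned-boundary : ∀ {q r x y} → DistinctLetters x y → p ∣ z ⊎ q ≡ 0 → x ≡ₚ y → x ⊓ y ≡ r → suc r ≡ m →
                       LeftStep (r + q * m) x y
    aligned-boundary {q} {r} {x} {y} distinct p∣z⊎q≡0 x≡ₚy ⊓≡r sr≡m =
      subst (λ N → LeftState N (nextA x y) (nextB x y)) (sym N≡) (zeroZ-state q (special-zeroZ sp) p∣z⊎q≡0) , (begin
        fL x y ++ φ* (zPow (r + q * m))    ≡⟨ cong₂ (λ u k → u ++ φ* (zPow (k + q * m))) (special-fL sp) r≡m∸1 ⟩
        base ++ φ* (zPow (m ∸ 1 + q * m))  ≡⟨ zPow-boundary-chain q p∣z⊎q≡0 ⟩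
        zPow (suc q * m)                   ≡⟨ cong zPow (sym N≡) ⟩
        zPow (suc (r + q * m))             ∎)
      where
      open ≡-Reasoning
      r≡m∸1 = cong pred sr≡m
      sp = congruent-special distinct x≡ₚy (trans ⊓≡r r≡m∸1)
      N≡ : suc (r + q * m) ≡ suc q * m
      N≡ = cong (_+ q * m) sr≡m

    drifting-step : ∀ {q r x y} → DistinctLetters x y → ¬ p ∣ z → 1 ≤ q → ¬ x ≡ₚ y → r < m →
                    LeftStep (r + q * m) x y
    drifting-step {q} {r} distinct p∤z 1≤q x≢ₚy r<m with incongruent-next distinct x≢ₚy | suc r <? m
    ... | (distinct′ , x′≢ₚy′) , fL≡[] | yes sr<m =
      leftState q (suc r) refl sr<m distinct′ (drifting p∤z 1≤q x′≢ₚy′) ,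
      trans (cong (_++ φ* (zPow (r + q * m))) fL≡[]) (φ*-zPow q sr<m)
    ... | (distinct′ , x′≢ₚy′) , fL≡[] | no sr≮m =
      leftState (suc q) 0 N≡ (>-nonZero⁻¹ m) distinct′ (drifting p∤z (s≤s z≤n) x′≢ₚy′) , (begin
        fL _ _ ++ φ* (zPow (r + q * m)) ≡⟨ cong₂ (λ u k → u ++ φ* (zPow (k + q * m))) fL≡[] (cong pred sr≡m) ⟩
        φ* (zPow (m ∸ 1 + q * m))       ≡⟨ zPow-boundary-single q p∤z 1≤q ⟩
        zPow (suc q * m)                ≡⟨ cong zPow (sym N≡) ⟩
        zPow (suc (r + q * m))          ∎)
      where
      open ≡-Reasoning
      sr≡m = ≤-antisym r<m (≮⇒≥ sr≮m)
      N≡ : suc (r + q * m) ≡ suc q * m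
      N≡ = cong (_+ q * m) sr≡m

    leftState-step : ∀ {N x y} → LeftState N x y → LeftStep N x y
    leftState-step (leftState q r refl r<m distinct (aligned p∣z⊎q≡0 x≡ₚy ⊓≡r)) with suc r <? m
    ... | yes sr<m = aligned-inner distinct p∣z⊎q≡0 x≡ₚy ⊓≡r sr<m
    ... | no  sr≮m = aligned-boundary distinct p∣z⊎q≡0 x≡ₚy ⊓≡r (≤-antisym r<m (≮⇒≥ sr≮m))
    leftState-step (leftState q r refl r<m distinct (drifting p∤z 1≤q x≢ₚy)) = drifting-step distinct p∤z 1≤q x≢ₚy r<m

    fPrefix-congruent : ∀ B → let a = BS.la B; b = BS.lb B in DistinctLetters a b → a ≡ₚ b → ∀ n →
      LeftState (n + a ⊓ b) (BS.la (fIter n B)) (BS.lb (fIter n B)) × fPrefix n B ≡ zPow (n + a ⊓ b)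
    fPrefix-congruent B distinct a≡ₚb zero =
      leftState 0 _ (sym (+-identityʳ _)) ⊓<m distinct (aligned (inj₂ refl) a≡ₚb refl) , sym (zPow-< ⊓<m)
      where ⊓<m = congruent-⊓<m distinct a≡ₚb
    fPrefix-congruent B distinct a≡ₚb (suc n) with fPrefix-congruent B distinct a≡ₚb n
    ... | state , prefix≡ with leftState-step state
    ...   | state′ , step≡ = state′ , trans (cong (λ w → fL (BS.la (fIter n B)) (BS.lb (fIter n B)) ++ φ* w) prefix≡) step≡

    fPrefix-incongruent : ∀ B → DistinctLetters (BS.la B) (BS.lb B) → ¬ BS.la B ≡ₚ BS.lb B → ∀ n →
      let Bₙ = fIter n B in (DistinctLetters (BS.la Bₙ) (BS.lb Bₙ) × ¬ BS.la Bₙ ≡ₚ BS.lb Bₙ) × fPrefix n B ≡ []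
    fPrefix-incongruent B distinct a≢ₚb zero = (distinct , a≢ₚb) , refl
    fPrefix-incongruent B distinct a≢ₚb (suc n) with fPrefix-incongruent B distinct a≢ₚb n
    ... | (distinctₙ , ≢ₚₙ) , prefix≡[] with incongruent-next distinctₙ ≢ₚₙ
    ...   | next , fL≡[] = next , cong₂ (λ u w → u ++ φ* w) fL≡[] prefix≡[]

    fPrefix≡u1 : ∀ {a b c d v} → DistinctLetters a b → ∀ n → fPrefix n (bs a b c d v) ≡ u1 a b n
    fPrefix≡u1 {a} {b} {c} {d} {v} distinct n with a % p ≟ b % p
    ... | yes a≡ₚb = trans (proj₂ (fPrefix-congruent (bs a b c d v) distinct a≡ₚb n))
                           (sym (if-yes (p ∣? ∣ a - b ∣) (Equivalence.to (%≡%⇔∣∣-∣ p a b) a≡ₚb)))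
    ... | no  a≢ₚb = trans (proj₂ (fPrefix-incongruent (bs a b c d v) distinct a≢ₚb n))
                           (sym (if-no (p ∣? ∣ a - b ∣) (a≢ₚb ∘ Equivalence.from (%≡%⇔∣∣-∣ p a b))))

lemma4p10 : (m p : ℕ) {{_ : NonZero m}} {{_ : NonZero p}} (t : ℕ → ℕ) →
    let open Setting m p t in
    NonSimpleParry →
    (a b c d : ℕ) (v : List ℕ) →
    Bispecial a b c d v →
    (λ j → tIdx (c + suc j)) ≼ (λ j → tIdx (d + suc j)) →
    (n : ℕ) →
    (BS.word (fIter n (bs a b c d v))
       ≡ u1 a b n ++ φ^ n v ++ lcp (φ^ n [ c ]) (φ^ n [ d ]))
    × (φ^ n [ c ] ≡ lcp (φ^ n [ c ]) (φ^ n [ d ]) ++ [ c ⊕ n ])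
lemma4p10 m p t (_ , tm≢tm+p , minimal-period , nonzero-digit , parry) a b c d v
          (a<m+p , b<m+p , c<m+p , d<m+p , a≢b , c≢d , _ , _) c≼d n =
  (begin
    BS.word (fIter n B₀)                   ≡⟨ fIter-word n B₀ ⟩
    fPrefix n B₀ ++ φ^ n v ++ fSuffix n B₀ ≡⟨ cong₂ (λ u w → u ++ φ^ n v ++ w) prefix≡u1 (sym (proj₁ suffix≡lcp)) ⟩
    u1 a b n ++ φ^ n v ++ lcp (φ^ n [ c ]) (φ^ n [ d ]) ∎) ,
  trans (proj₂ suffix≡lcp) (cong (_++ [ c ⊕ n ]) (sym (proj₁ suffix≡lcp)))
  where
  open ≡-Reasoning
  open Setting m p t
  open Expansion m p t
  B₀ = bs a b c d v
  c≺d = tFrom-≼⇒≺ tm≢tm+p minimal-period c<m+p d<m+p c≢d c≼d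
  prefix≡u1 = fPrefix≡u1 nonzero-digit tm≢tm+p (a<m+p , b<m+p , a≢b) n
  suffix≡lcp = fSuffix≡lcp parry c<m+p d<m+p c≺d n
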